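{- Let $R_\times=R(\mathbb F_2^2,\{x,y\})$, where $x,y$ are the two coordinate linear forms on $\mathbb F_2^2$. There is a family of $n$-vertex $3$-graphs $G_\alpha(n)$, indexed by $\alpha\in(0,1/2)$ and $n\in\mathbb N$, each a blowup of $R_\times$, such that \[|G_\alpha(n)|=\left(\tfrac1{27}+o(1)\right)n^3=\left(\tfrac29+o(1)\right)\binom n3,\] and for every distinct $\alpha,\beta\in(0,1/2)$, $\mathrm{dist}(G_\alpha(n),G_\beta(n))=\Omega_{\alpha,\beta}(n^3)$ as $n\to\infty$.
   Context: For a finite-dimensional $\mathbb F_2$-vector space $U$ and a set $\mathcal C$ of nonzero linear forms on $U$, the cut template $R(U,\mathcal C)$ is the $3$-graph with vertex set $\{a_c:c\in\mathcal C\}\sqcup U$ whose edges are exactly the triples $\{a_c,u,v\}$ with $c\in\mathcal C$, $u,v\in U$ distinct, and $c(u+v)=1$. For a $3$-graph $G$ on $[m]$ and pairwise disjoint (possibly empty) sets $V_1,\dots,V_m$, the blowup $G[V_1,\dots,V_m]$ has vertex set $\bigcup V_i$ and edges all triples $\{x,y,z\}$ with $x\in V_i,y\in V_j,z\in V_k$ for some $ijk\in G$. $|H|$ denotes the number of edges. For $3$-graphs $G,H$ on the same number of vertices, $\mathrm{dist}(G,H)=\min_{\psi}|\psi(G)\triangle H|$, the minimum over bijections $\psi:V(G)\to V(H)$. -}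

module Defs where

open import Data.Bool using (Bool; true; false; _∧_; _xor_; not)
open import Data.Nat as ℕ using (ℕ; zero; suc; _≤_; _*_; _^_; _+_)
open import Data.Nat.Combinatorics using (_C_)
open import Data.Integer as ℤ using (ℤ; +_)
open import Data.Fin using (Fin; _<?_)
open import Data.Fin.Properties using (_≟_)
open import Data.List using (List; []; _∷_; map; concatMap; allFin)
open import Data.Nat.ListAction using (sum)
open import Data.Vec using (Vec; []; _∷_; foldr; zipWith; lookup)
open import Data.Sum using (_⊎_; inj₁; inj₂)
open import Data.Product using (Σ; ∃; ∃-syntax; _×_; _,_)
open import Relation.Nullary.Decidable using (isYes)
open import Function.Bundles using (_↔_; Inverse)
import Data.Rational as ℚ
open ℚ using (ℚ; 0ℚ)

-- Constructive (Bishop-regular) real numbers, used only as index set.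

record ℝ : Set where
  field
    seq : ℕ → ℚ
    reg : ∀ m n → ℚ.∣ seq m ℚ.- seq n ∣ ℚ.≤ (+ 1 ℚ./ suc m) ℚ.+ (+ 1 ℚ./ suc n)
open ℝ public

Positive : ℝ → Set
Positive x = ∃[ n ] (+ 1 ℚ./ suc n) ℚ.< seq x n

BelowHalf : ℝ → Set
BelowHalf x = ∃[ n ] (+ 1 ℚ./ suc n) ℚ.< ((+ 1 ℚ./ 2) ℚ.- seq x n)

-- apartness (constructive "distinct"):  |x - y| > 0
Apart : ℝ → ℝ → Set
Apart x y = ∃[ n ] (+ 2 ℚ./ suc n) ℚ.< ℚ.∣ seq x n ℚ.- seq y n ∣

F2Vec : ℕ → Set
F2Vec d = Vec Bool d

_⊕_ : ∀ {d} → F2Vec d → F2Vec d → F2Vec d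
u ⊕ v = zipWith _xor_ u v

evalForm : ∀ {d} → F2Vec d → F2Vec d → Bool
evalForm c u = foldr _ _xor_ false (zipWith _∧_ c u)

vecEq : ∀ {d} → F2Vec d → F2Vec d → Bool
vecEq [] [] = true
vecEq (a ∷ u) (b ∷ v) = not (a xor b) ∧ vecEq u v

-- vertices of R(F_2^d, C) with |C| = k : a_c (c ∈ C) ⊔ F_2^d
TVertex : ℕ → ℕ → Set
TVertex k d = Fin k ⊎ F2Vec d

-- 3-graphs on vertex type V, as symmetric Bool-valued triple predicates
Graph3 : Set → Set
Graph3 V = V → V → V → Bool

cutTemplate : ∀ {k d} → Vec (F2Vec d) k → Graph3 (TVertex k d)
cutTemplate {k} {d} forms = E
  where
  cut : Fin k → F2Vec d → F2Vec d → Bool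
  cut c u v = not (vecEq u v) ∧ evalForm (lookup forms c) (u ⊕ v)
  E : Graph3 (TVertex k d)
  E (inj₁ c) (inj₂ u) (inj₂ v) = cut c u v
  E (inj₂ u) (inj₁ c) (inj₂ v) = cut c u v
  E (inj₂ u) (inj₂ v) (inj₁ c) = cut c u v
  E _ _ _ = false

Rtimes : Graph3 (TVertex 2 2)
Rtimes = cutTemplate ((true ∷ false ∷ []) ∷ (false ∷ true ∷ []) ∷ [])

-- Blowup of a template T with vertex set Fin n: vertex i lies in the
-- part V_{f i}.  {x,y,z} is an edge iff {f x, f y, f z} is an edge of T.
blowup : ∀ {V : Set} {n} → Graph3 V → (Fin n → V) → Graph3 (Fin n)
blowup T f x y z = T (f x) (f y) (f z)

triples : (n : ℕ) → List (Fin n × Fin n × Fin n)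
triples n = concatMap (λ i → concatMap (λ j → map (λ k → (i , j , k)) (allFin n)) (allFin n)) (allFin n)

countTriples : ∀ {n} → (Fin n → Fin n → Fin n → Bool) → ℕ
countTriples {n} P = sum (map f (triples n))
  where
  f : Fin n × Fin n × Fin n → ℕ
  f (i , j , k) with isYes (i <? j) ∧ isYes (j <? k) ∧ P i j k
  ... | true = 1
  ... | false = 0

size : ∀ {n} → Graph3 (Fin n) → ℕ
size G = countTriples G

relabel : ∀ {n} → (Fin n ↔ Fin n) → Graph3 (Fin n) → Graph3 (Fin n)
relabel ψ G a b c = G (from a) (from b) (from c)
  where open Inverse ψ

symDiff : ∀ {n} → Graph3 (Fin n) → Graph3 (Fin n) → ℕ
symDiff G H = countTriples (λ a b c → G a b c xor H a b c)

-- dist(G,H) ≥ m  (dist = min over bijections ψ of |ψ(G) △ H|)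
DistAtLeast : ∀ {n} → Graph3 (Fin n) → Graph3 (Fin n) → ℕ → Set
DistAtLeast G H m = ∀ ψ → m ≤ symDiff (relabel ψ G) H

-- |G_n| = (1/27 + o(1)) n^3 :  for every ε = 1/(m+1) > 0, eventually
--   |27 |G_n| - n^3| ≤ ε n^3
EdgesAsymp : (e : ℕ → ℕ) → Set
EdgesAsymp e = ∀ m → ∃[ N ] ∀ n → N ≤ n →
  suc m * ℤ.∣ (+ (27 * e n)) ℤ.- (+ (n ^ 3)) ∣ ≤ n ^ 3

EdgesAsympBinom : (e : ℕ → ℕ) → Set
EdgesAsympBinom e = ∀ m → ∃[ N ] ∀ n → N ≤ n →
  suc m * ℤ.∣ (+ (9 * e n)) ℤ.- (+ (2 * (n C 3))) ∣ ≤ 2 * (n C 3)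

-- f(n) = Ω(n^3):  there are constants K ≥ 1 and N with n^3 ≤ K·f(n) for n ≥ N
-- (formulated for dist via DistAtLeast)
DistOmegaCube : (G H : (n : ℕ) → Graph3 (Fin n)) → Set
DistOmegaCube G H = ∃[ K ] ∃[ N ] ∀ n → N ≤ n →
  Σ ℕ λ d → (n ^ 3 ≤ K * d) × DistAtLeast (G n) (H n) d

{-# OPTIONS --safe #-}
module Submission where

-- Write n = 6h + r with r < 6. For a ≤ h let G_a(n) be the blowup of R× whose parts on
-- a_y, 00, 01, 10, 11, a_x have sizes h, a, b, b, a, h + r, where a + b = 2h. Each G_a(n) has
-- exactly (2h + r)(2h)² = (1/27 + o(1)) n³ edges. The sum of squared codegrees ∑codeg² does not
-- change under relabelling, changes by at most 12n when one edge is flipped, and satisfies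
-- ∑codeg²(G_a) + 8(h + r)h·ab = c(n), where c(n) does not depend on a. Since ab = a(2h − a) moves
-- by at least (a − a′)², dist(G_a, G_a′) ≥ 8(h + r)h(a − a′)² / 12n. For α ∈ (0, 1/2) take
-- a ≈ αh: then apart α, β give |a − a′| = Ω(h), hence distance Ω(n³).

open import Defs
open import Level using (0ℓ)
open import Algebra.Bundles.Raw using (RawSemiring)
open import Data.Bool using (Bool; true; false; _∧_; _xor_; not)
open import Data.Bool.Properties using (xor-comm; ∧-assoc; ∧-comm)
open import Data.Nat
  using (ℕ; zero; suc; _+_; _*_; _∸_; _^_; _/_; _%_; _≤_; _<_; z≤n; s≤s; s≤s⁻¹; ∣_-_∣; NonZero; >-nonZero;
         +-*-rawSemiring)
open import Data.Nat.Properties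
open import Data.Nat.DivMod using (m≡m%n+[m/n]*n; m%n<n; m%n≤m; m/n≤m; m/n*n≤m; /-monoˡ-≤; m*n/n≡m; m≥n⇒m/n>0)
open import Data.Nat.Combinatorics using (_C_; nCk+nC[k+1]≡[n+1]C[k+1]; nC1≡n)
open import Data.Nat.ListAction using () renaming (sum to sumᴸ)
open import Data.Nat.ListAction.Properties using () renaming (sum-++ to sumᴸ-++)
open import Data.Nat.Tactic.RingSolver using (solve-∀)
import Data.Integer as ℤ
import Data.Integer.Properties as ℤ
open import Data.Integer.Tactic.RingSolver using () renaming (solve-∀ to ℤ-solve-∀)
open import Data.Rational as ℚ using (ℚ; mkℚ; 0ℚ; 1ℚ; ½)
import Data.Rational.Properties as ℚ
import Data.Rational.Unnormalised as ℚᵘ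
import Data.Rational.Unnormalised.Properties as ℚᵘ
open import Data.Fin as Fin using (Fin; zero; suc; cast)
open import Data.Fin.Properties using (cast-is-id; toℕ-injective)
open import Data.Fin.Permutation using (flip)
open import Data.List using (List; []; _∷_; _++_; map; concatMap; allFin; tabulate)
import Data.List.Properties as List
open import Data.Vec using (Vec; []; _∷_; lookup)
open import Data.Product using (Σ; ∃-syntax; _×_; _,_; proj₁; proj₂)
open import Data.Sum using (_⊎_; inj₁; inj₂)
open import Data.Empty using (⊥-elim)
open import Function using (id)
open import Function.Bundles using (_↔_; Inverse)
open import Relation.Binary.PropositionalEquality
  using (_≡_; refl; sym; trans; cong; cong₂; subst; subst₂; module ≡-Reasoning)
open import Relation.Nullary using (Dec; yes; no; ¬_; contradiction)
open import Relation.Nullary.Decidable using (isYes; isYes≗does; dec-true; dec-false)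
open import Algebra.Properties.Semiring.Sum +-*-semiring
  using (sum; sum-syntax; ∑-distrib-+; ∑-comm; ∑-permute; sum-cong-≗; *-distribˡ-sum)

[_] : Bool → ℕ
[ true ] = 1
[ false ] = 0

[]≤1 : ∀ b → [ b ] ≤ 1
[]≤1 true = ≤-refl
[]≤1 false = z≤n

[]≤[]+[xor] : ∀ a b → [ a ] ≤ [ b ] + [ a xor b ]
[]≤[]+[xor] true  true  = s≤s z≤n
[]≤[]+[xor] true  false = s≤s z≤n
[]≤[]+[xor] false _     = z≤n

∑-mono-≤ : ∀ {n} {f g : Fin n → ℕ} → (∀ i → f i ≤ g i) → sum f ≤ sum g
∑-mono-≤ {zero} f≤g = z≤n
∑-mono-≤ {suc n} f≤g = +-mono-≤ (f≤g zero) (∑-mono-≤ (λ i → f≤g (suc i)))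

∑[]≤n : ∀ {n} (P : Fin n → Bool) → ∑[ i < n ] [ P i ] ≤ n
∑[]≤n {zero} P = z≤n
∑[]≤n {suc n} P = +-mono-≤ ([]≤1 (P zero)) (∑[]≤n (λ i → P (suc i)))

∑-cast : ∀ {m n} (eq : m ≡ n) (f : Fin n → ℕ) → ∑[ i < m ] f (cast eq i) ≡ ∑[ i < n ] f i
∑-cast refl f = sum-cong-≗ (λ i → cong f (cast-is-id refl i))

∑-relabel : ∀ {n} (ψ : Fin n ↔ Fin n) (f : Fin n → ℕ) → ∑[ i < n ] f (Inverse.from ψ i) ≡ ∑[ i < n ] f i
∑-relabel ψ f = sym (∑-permute f (flip ψ))

∑³ : ∀ n → (Fin n → Fin n → Fin n → ℕ) → ℕ
∑³ n F = ∑[ i < n ] ∑[ j < n ] ∑[ k < n ] F i j k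

∑³-cong : ∀ {n} {F G : Fin n → Fin n → Fin n → ℕ} → (∀ i j k → F i j k ≡ G i j k) → ∑³ n F ≡ ∑³ n G
∑³-cong F≡G = sum-cong-≗ (λ i → sum-cong-≗ (λ j → sum-cong-≗ (F≡G i j)))

∑³-+-cong : ∀ {n} {F G : Fin n → Fin n → Fin n → ℕ} {a b} → ∑³ n F ≡ a → ∑³ n G ≡ b →
  ∑³ n (λ i j k → F i j k + G i j k) ≡ a + b
∑³-+-cong {n} {F} {G} ∑F ∑G = trans distrib (cong₂ _+_ ∑F ∑G)
  where
  distrib : ∑³ n (λ i j k → F i j k + G i j k) ≡ ∑³ n F + ∑³ n G
  distrib = trans
    (sum-cong-≗ (λ i → trans (sum-cong-≗ (λ j → ∑-distrib-+ (F i j) (G i j)))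
                             (∑-distrib-+ (λ j → sum (F i j)) (λ j → sum (G i j)))))
    (∑-distrib-+ (λ i → ∑[ j < n ] sum (F i j)) (λ i → ∑[ j < n ] sum (G i j)))

∑³-swap₁₂ : ∀ {n} (F : Fin n → Fin n → Fin n → ℕ) → ∑³ n (λ i j k → F j i k) ≡ ∑³ n F
∑³-swap₁₂ F = ∑-comm (λ i j → sum (F j i))

∑³-swap₂₃ : ∀ {n} (F : Fin n → Fin n → Fin n → ℕ) → ∑³ n (λ i j k → F i k j) ≡ ∑³ n F
∑³-swap₂₃ F = sum-cong-≗ (λ i → ∑-comm (λ j k → F i k j))

sumᴸ-concatMap : ∀ {A B : Set} (f : B → ℕ) (g : A → List B) xs →
  sumᴸ (map f (concatMap g xs)) ≡ sumᴸ (map (λ x → sumᴸ (map f (g x))) xs)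
sumᴸ-concatMap f g [] = refl
sumᴸ-concatMap f g (x ∷ xs) = begin
  sumᴸ (map f (g x ++ concatMap g xs))               ≡⟨ cong sumᴸ (List.map-++ f (g x) _) ⟩
  sumᴸ (map f (g x) ++ map f (concatMap g xs))       ≡⟨ sumᴸ-++ (map f (g x)) _ ⟩
  sumᴸ (map f (g x)) + sumᴸ (map f (concatMap g xs)) ≡⟨ cong (sumᴸ (map f (g x)) +_) (sumᴸ-concatMap f g xs) ⟩
  sumᴸ (map f (g x)) + sumᴸ (map (λ x → sumᴸ (map f (g x))) xs) ∎
  where open ≡-Reasoning

sumᴸ-allFin : ∀ n (f : Fin n → ℕ) → sumᴸ (map f (allFin n)) ≡ ∑[ i < n ] f i
sumᴸ-allFin n f = trans (cong sumᴸ (List.map-tabulate id f)) (sumᴸ-tabulate n f)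
  where
  sumᴸ-tabulate : ∀ n (f : Fin n → ℕ) → sumᴸ (tabulate f) ≡ sum f
  sumᴸ-tabulate zero f = refl
  sumᴸ-tabulate (suc n) f = cong (f zero +_) (sumᴸ-tabulate n (λ i → f (suc i)))

sumᴸ-concatMap-allFin : ∀ {B : Set} n (f : B → ℕ) (g : Fin n → List B) →
  sumᴸ (map f (concatMap g (allFin n))) ≡ ∑[ i < n ] sumᴸ (map f (g i))
sumᴸ-concatMap-allFin n f g =
  trans (sumᴸ-concatMap f g (allFin n)) (sumᴸ-allFin n (λ i → sumᴸ (map f (g i))))

sumᴸ-triples : ∀ {n} (f : Fin n × Fin n × Fin n → ℕ) →
  sumᴸ (map f (triples n)) ≡ ∑³ n (λ i j k → f (i , j , k))
sumᴸ-triples {n} f = trans (sumᴸ-concatMap-allFin n f _) (sum-cong-≗ λ i →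
  trans (sumᴸ-concatMap-allFin n f _) (sum-cong-≗ λ j →
  trans (cong sumᴸ (sym (List.map-∘ (allFin n)))) (sumᴸ-allFin n (λ k → f (i , j , k)))))

record Simple {V : Set} (G : Graph3 V) : Set where
  field
    swap₁₂ : ∀ x y z → G x y z ≡ G y x z
    swap₂₃ : ∀ x y z → G x y z ≡ G x z y
    loop   : ∀ x z → G x x z ≡ false

  swap₁₃ : ∀ x y z → G x y z ≡ G z y x
  swap₁₃ x y z = trans (swap₁₂ x y z) (trans (swap₂₃ y x z) (swap₁₂ y z x))

  loop₂₃ : ∀ x z → G x z z ≡ false
  loop₂₃ x z = trans (swap₁₃ x z z) (loop z x)

  loop₁₃ : ∀ x z → G x z x ≡ false
  loop₁₃ x z = trans (swap₂₃ x z x) (loop x z)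

lt : ∀ {n} → Fin n → Fin n → Bool
lt i j = isYes (i Fin.<? j)

lt-flip : ∀ {n} {i j : Fin n} → ¬ i ≡ j → lt j i ≡ not (lt i j)
lt-flip {i = i} {j} i≢j with i Fin.<? j | j Fin.<? i
... | yes i<j | yes j<i = ⊥-elim (<-asym i<j j<i)
... | yes _   | no _    = refl
... | no _    | yes _   = refl
... | no i≮j  | no j≮i  = ⊥-elim (i≢j (toℕ-injective (≤-antisym (≮⇒≥ j≮i) (≮⇒≥ i≮j))))

lt-trans : ∀ {n} {i j k : Fin n} → lt i j ≡ true → lt j k ≡ true → lt i k ≡ true
lt-trans {i = i} {j} {k} _ _ with i Fin.<? j | j Fin.<? k | i Fin.<? k
... | yes i<j | yes j<k | no i≮k = ⊥-elim (i≮k (<-trans i<j j<k))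
... | yes _   | yes _   | yes _  = refl

lt-trans-false : ∀ {n} {i j k : Fin n} → lt i j ≡ false → lt j k ≡ false → lt i k ≡ false
lt-trans-false {i = i} {j} {k} _ _ with i Fin.<? j | j Fin.<? k | i Fin.<? k
... | no i≮j | no j≮k | yes i<k = ⊥-elim (<-irrefl refl (<-≤-trans i<k (≤-trans (≮⇒≥ j≮k) (≮⇒≥ i≮j))))
... | no _   | no _   | no _    = refl

-- x, y, z stand for i < j, j < k, i < k; the six summands are the six orderings of i, j, k.
exactly-one-ordering : ∀ x y z → (x ≡ true → y ≡ true → z ≡ true) → (x ≡ false → y ≡ false → z ≡ false) →
  1 ≡ [ x ∧ y ] + [ z ∧ not y ] + [ not x ∧ z ] + [ y ∧ not z ] + [ not z ∧ x ] + [ not y ∧ not x ]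
exactly-one-ordering true  true  false ↑ _ = contradiction (↑ refl refl) λ ()
exactly-one-ordering false false true  _ ↓ = contradiction (↓ refl refl) λ ()
exactly-one-ordering true  true  true  _ _ = refl
exactly-one-ordering true  false true  _ _ = refl
exactly-one-ordering true  false false _ _ = refl
exactly-one-ordering false true  true  _ _ = refl
exactly-one-ordering false true  false _ _ = refl
exactly-one-ordering false false false _ _ = refl

module _ {n} (G : Graph3 (Fin n)) where

  increasing : Fin n → Fin n → Fin n → ℕ
  increasing i j k = [ G i j k ∧ lt i j ∧ lt j k ]

  -- countTriples hides its summand in a where-block; unification recovers it.
  private
    summand : Σ (Fin n × Fin n × Fin n → ℕ) λ f → countTriples G ≡ sumᴸ (map f (triples n))
    summand = _ , refl

    summand≡increasing : ∀ i j k → proj₁ summand (i , j , k) ≡ increasing i j k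
    summand≡increasing i j k = trans unfold (cong [_] (rotate (lt i j) (lt j k) (G i j k)))
      where
      unfold : proj₁ summand (i , j , k) ≡ [ lt i j ∧ lt j k ∧ G i j k ]
      unfold with lt i j ∧ lt j k ∧ G i j k
      ... | true  = refl
      ... | false = refl
      rotate : ∀ a b c → a ∧ b ∧ c ≡ c ∧ a ∧ b
      rotate a b c = trans (sym (∧-assoc a b c)) (∧-comm (a ∧ b) c)

  countTriples≡∑³ : countTriples G ≡ ∑³ n increasing
  countTriples≡∑³ = begin
    countTriples G                              ≡⟨ proj₂ summand ⟩
    sumᴸ (map (proj₁ summand) (triples n))       ≡⟨ sumᴸ-triples (proj₁ summand) ⟩
    ∑³ n (λ i j k → proj₁ summand (i , j , k))   ≡⟨ ∑³-cong summand≡increasing ⟩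
    ∑³ n increasing                             ∎
    where open ≡-Reasoning

  module _ (simple : Simple G) where
    open Simple simple

    [G]≡∑orderings : ∀ i j k → [ G i j k ] ≡
      increasing i j k + increasing i k j + increasing j i k + increasing j k i + increasing k i j + increasing k j i
    -- The symmetries of G turn each G σ(i, j, k) into G i j k; then only the orderings differ.
    [G]≡∑orderings i j k
      rewrite sym (swap₂₃ i j k) | sym (swap₁₂ i j k) | sym (trans (swap₁₂ i j k) (swap₂₃ j i k))
            | sym (trans (swap₂₃ i j k) (swap₁₂ i k j)) | sym (swap₁₃ i j k)
      = split (G i j k) refl
      where
      split : ∀ g → G i j k ≡ g → [ g ] ≡
        [ g ∧ lt i j ∧ lt j k ] + [ g ∧ lt i k ∧ lt k j ] + [ g ∧ lt j i ∧ lt i k ] +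
        [ g ∧ lt j k ∧ lt k i ] + [ g ∧ lt k i ∧ lt i j ] + [ g ∧ lt k j ∧ lt j i ]
      split false _ = refl
      split true edge
        rewrite lt-flip {i = j} {k} (λ { refl → contradiction (trans (sym edge) (loop₂₃ i j)) λ () })
              | lt-flip {i = i} {j} (λ { refl → contradiction (trans (sym edge) (loop i k)) λ () })
              | lt-flip {i = i} {k} (λ { refl → contradiction (trans (sym edge) (loop₁₃ i j)) λ () })
        = exactly-one-ordering (lt i j) (lt j k) (lt i k) lt-trans lt-trans-false

    ∑³[G]≡6*countTriples : ∑³ n (λ i j k → [ G i j k ]) ≡ 6 * countTriples G
    ∑³[G]≡6*countTriples = begin
      ∑³ n (λ i j k → [ G i j k ])
        ≡⟨ ∑³-cong [G]≡∑orderings ⟩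
      ∑³ n (λ i j k → I i j k + I i k j + I j i k + I j k i + I k i j + I k j i)
        ≡⟨ ∑³+ (∑³+ (∑³+ (∑³+ (∑³+ refl ∑I₁₃₂) ∑I₂₁₃) ∑I₂₃₁) ∑I₃₁₂) ∑I₃₂₁ ⟩
      S + S + S + S + S + S
        ≡⟨ six-copies S ⟩
      6 * S
        ≡⟨ cong (6 *_) countTriples≡∑³ ⟨
      6 * countTriples G ∎
      where
      open ≡-Reasoning
      I = increasing
      S = ∑³ n I
      ∑³+ = ∑³-+-cong {n}
      six-copies : ∀ s → s + s + s + s + s + s ≡ 6 * s
      six-copies = solve-∀
      ∑I₁₃₂ : ∑³ n (λ i j k → I i k j) ≡ S
      ∑I₁₃₂ = ∑³-swap₂₃ I
      ∑I₂₁₃ : ∑³ n (λ i j k → I j i k) ≡ S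
      ∑I₂₁₃ = ∑³-swap₁₂ I
      ∑I₂₃₁ : ∑³ n (λ i j k → I j k i) ≡ S
      ∑I₂₃₁ = trans (∑³-swap₁₂ (λ i j k → I i k j)) ∑I₁₃₂
      ∑I₃₁₂ : ∑³ n (λ i j k → I k i j) ≡ S
      ∑I₃₁₂ = trans (∑³-swap₂₃ (λ i j k → I j i k)) ∑I₂₁₃
      ∑I₃₂₁ : ∑³ n (λ i j k → I k j i) ≡ S
      ∑I₃₂₁ = trans (∑³-swap₁₂ (λ i j k → I k i j)) ∑I₃₁₂

symDiff-comm : ∀ {n} (G H : Graph3 (Fin n)) → symDiff G H ≡ symDiff H G
symDiff-comm {n} G H = begin
  symDiff G H                ≡⟨ countTriples≡∑³ G⊕H ⟩
  ∑³ n (increasing G⊕H)      ≡⟨ ∑³-cong {n} (λ i j k → cong (λ b → [ b ∧ lt i j ∧ lt j k ]) (xor-comm (G i j k) _)) ⟩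
  ∑³ n (increasing H⊕G)      ≡⟨ countTriples≡∑³ H⊕G ⟨
  symDiff H G                ∎
  where
  open ≡-Reasoning
  G⊕H H⊕G : Graph3 (Fin n)
  G⊕H i j k = G i j k xor H i j k
  H⊕G i j k = H i j k xor G i j k

vecEq-refl : ∀ {d} (u : F2Vec d) → vecEq u u ≡ true
vecEq-refl [] = refl
vecEq-refl (true ∷ u) = vecEq-refl u
vecEq-refl (false ∷ u) = vecEq-refl u

vecEq-comm : ∀ {d} (u v : F2Vec d) → vecEq u v ≡ vecEq v u
vecEq-comm [] [] = refl
vecEq-comm (a ∷ u) (b ∷ v) = cong₂ (λ c e → not c ∧ e) (xor-comm a b) (vecEq-comm u v)

⊕-comm : ∀ {d} (u v : F2Vec d) → u ⊕ v ≡ v ⊕ u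
⊕-comm [] [] = refl
⊕-comm (a ∷ u) (b ∷ v) = cong₂ _∷_ (xor-comm a b) (⊕-comm u v)

cutTemplate-simple : ∀ {k d} (forms : Vec (F2Vec d) k) → Simple (cutTemplate forms)
cutTemplate-simple forms = record { swap₁₂ = swap₁₂ ; swap₂₃ = swap₂₃ ; loop = loop }
  where
  cut-comm : ∀ c u v → cutTemplate forms (inj₂ u) (inj₂ v) (inj₁ c) ≡ cutTemplate forms (inj₂ v) (inj₂ u) (inj₁ c)
  cut-comm c u v = cong₂ (λ e w → not e ∧ evalForm (lookup forms c) w) (vecEq-comm u v) (⊕-comm u v)
  swap₁₂ : ∀ x y z → cutTemplate forms x y z ≡ cutTemplate forms y x z
  swap₁₂ (inj₁ _) (inj₁ _) (inj₁ _) = refl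
  swap₁₂ (inj₁ _) (inj₁ _) (inj₂ _) = refl
  swap₁₂ (inj₁ _) (inj₂ _) (inj₁ _) = refl
  swap₁₂ (inj₁ _) (inj₂ _) (inj₂ _) = refl
  swap₁₂ (inj₂ _) (inj₁ _) (inj₁ _) = refl
  swap₁₂ (inj₂ _) (inj₁ _) (inj₂ _) = refl
  swap₁₂ (inj₂ u) (inj₂ v) (inj₁ c) = cut-comm c u v
  swap₁₂ (inj₂ _) (inj₂ _) (inj₂ _) = refl
  swap₂₃ : ∀ x y z → cutTemplate forms x y z ≡ cutTemplate forms x z y
  swap₂₃ (inj₁ _) (inj₁ _) (inj₁ _) = refl
  swap₂₃ (inj₁ _) (inj₁ _) (inj₂ _) = refl
  swap₂₃ (inj₁ _) (inj₂ _) (inj₁ _) = refl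
  swap₂₃ (inj₁ c) (inj₂ u) (inj₂ v) = cut-comm c u v
  swap₂₃ (inj₂ _) (inj₁ _) (inj₁ _) = refl
  swap₂₃ (inj₂ _) (inj₁ _) (inj₂ _) = refl
  swap₂₃ (inj₂ _) (inj₂ _) (inj₁ _) = refl
  swap₂₃ (inj₂ _) (inj₂ _) (inj₂ _) = refl
  loop : ∀ x z → cutTemplate forms x x z ≡ false
  loop (inj₁ _) _ = refl
  loop (inj₂ _) (inj₂ _) = refl
  loop (inj₂ u) (inj₁ c) = cong (λ e → not e ∧ evalForm (lookup forms c) (u ⊕ u)) (vecEq-refl u)

blowup-simple : ∀ {V n} {T : Graph3 V} (f : Fin n → V) → Simple T → Simple (blowup T f)
blowup-simple f T-simple = record
  { swap₁₂ = λ x y z → swap₁₂ (f x) (f y) (f z)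
  ; swap₂₃ = λ x y z → swap₂₃ (f x) (f y) (f z)
  ; loop   = λ x z → loop (f x) (f z)
  }
  where open Simple T-simple

relabel-simple : ∀ {n} {G : Graph3 (Fin n)} (ψ : Fin n ↔ Fin n) → Simple G → Simple (relabel ψ G)
relabel-simple ψ = blowup-simple (Inverse.from ψ)

xor-simple : ∀ {V} {G H : Graph3 V} → Simple G → Simple H → Simple (λ x y z → G x y z xor H x y z)
xor-simple G-simple H-simple = record
  { swap₁₂ = λ x y z → cong₂ _xor_ (G.swap₁₂ x y z) (H.swap₁₂ x y z)
  ; swap₂₃ = λ x y z → cong₂ _xor_ (G.swap₂₃ x y z) (H.swap₂₃ x y z)
  ; loop   = λ x z → cong₂ _xor_ (G.loop x z) (H.loop x z)
  }
  where
  module G = Simple G-simple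
  module H = Simple H-simple

-- Generic over the semiring so that the same weighted sums can be fed to the ring solver.
module Weighted (R : RawSemiring 0ℓ 0ℓ) {V : Set} where
  open RawSemiring R using (Carrier; 0#) renaming (_+_ to _+ᴿ_; _*_ to _*ᴿ_)

  weigh : List (V × Carrier) → (V → Carrier) → Carrier
  weigh [] φ = 0#
  weigh ((v , s) ∷ ps) φ = φ v *ᴿ s +ᴿ weigh ps φ

open Weighted +-*-rawSemiring using (weigh)

module _ {V : Set} where

  total : List (V × ℕ) → ℕ
  total [] = 0
  total ((_ , m) ∷ ps) = m + total ps

  layout : (ps : List (V × ℕ)) → Fin (total ps) → V
  layout ((v , zero) ∷ ps) i = layout ps i
  layout ((v , suc m) ∷ ps) zero = v
  layout ((v , suc m) ∷ ps) (suc i) = layout ((v , m) ∷ ps) i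

  ∑-layout : ∀ ps (φ : V → ℕ) → ∑[ i < total ps ] φ (layout ps i) ≡ weigh ps φ
  ∑-layout [] φ = refl
  ∑-layout ((v , zero) ∷ ps) φ = trans (∑-layout ps φ) (cong (_+ weigh ps φ) (sym (*-zeroʳ (φ v))))
  ∑-layout ((v , suc m) ∷ ps) φ = begin
    φ v + ∑[ i < m + total ps ] φ (layout ((v , m) ∷ ps) i) ≡⟨ cong (φ v +_) (∑-layout ((v , m) ∷ ps) φ) ⟩
    φ v + (φ v * m + weigh ps φ)                          ≡⟨ +-assoc (φ v) (φ v * m) _ ⟨
    φ v + φ v * m + weigh ps φ                            ≡⟨ cong (_+ weigh ps φ) (*-suc (φ v) m) ⟨
    φ v * suc m + weigh ps φ                              ∎
    where open ≡-Reasoning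

  layoutOn : ∀ {n} (ps : List (V × ℕ)) → n ≡ total ps → Fin n → V
  layoutOn ps eq i = layout ps (cast eq i)

  ∑-layoutOn : ∀ {n} ps (eq : n ≡ total ps) (φ : V → ℕ) → ∑[ i < n ] φ (layoutOn ps eq i) ≡ weigh ps φ
  ∑-layoutOn ps eq φ = trans (∑-cast eq (λ i → φ (layout ps i))) (∑-layout ps φ)

weightedCodegree : ∀ {V : Set} → Graph3 V → List (V × ℕ) → V → V → ℕ
weightedCodegree T ps p q = weigh ps (λ r → [ T p q r ])

codegree : ∀ {n} → Graph3 (Fin n) → Fin n → Fin n → ℕ
codegree {n} G i j = ∑[ k < n ] [ G i j k ]

∑codeg² : ∀ {n} → Graph3 (Fin n) → ℕ
∑codeg² {n} G = ∑[ i < n ] ∑[ j < n ] (codegree G i j * codegree G i j)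

module _ {V : Set} (T : Graph3 V) (ps : List (V × ℕ)) {n} (eq : n ≡ total ps) where

  private
    f : Fin n → V
    f = layoutOn ps eq

    c : V → V → ℕ
    c = weightedCodegree T ps

  6*size-blowup : Simple T →
    6 * size (blowup T (layoutOn ps eq)) ≡ weigh ps (λ p → weigh ps (λ q → weightedCodegree T ps p q))
  6*size-blowup T-simple = begin
    6 * size (blowup T f)
      ≡⟨ ∑³[G]≡6*countTriples (blowup T f) (blowup-simple f T-simple) ⟨
    ∑[ i < n ] ∑[ j < n ] ∑[ k < n ] [ T (f i) (f j) (f k) ]
      ≡⟨ sum-cong-≗ (λ i → sum-cong-≗ (λ j → ∑-layoutOn ps eq (λ r → [ T (f i) (f j) r ]))) ⟩
    ∑[ i < n ] ∑[ j < n ] c (f i) (f j)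
      ≡⟨ sum-cong-≗ (λ i → ∑-layoutOn ps eq (c (f i))) ⟩
    ∑[ i < n ] weigh ps (c (f i))
      ≡⟨ ∑-layoutOn ps eq (λ p → weigh ps (c p)) ⟩
    weigh ps (λ p → weigh ps (λ q → c p q)) ∎
    where open ≡-Reasoning

  ∑codeg²-blowup : let c = weightedCodegree T ps in
    ∑codeg² (blowup T (layoutOn ps eq)) ≡ weigh ps (λ p → weigh ps (λ q → c p q * c p q))
  ∑codeg²-blowup = begin
    ∑codeg² (blowup T f)
      ≡⟨ sum-cong-≗ (λ i → sum-cong-≗ (λ j → cong (λ d → d * d) (∑-layoutOn ps eq (λ r → [ T (f i) (f j) r ])))) ⟩
    ∑[ i < n ] ∑[ j < n ] (c (f i) (f j) * c (f i) (f j))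
      ≡⟨ sum-cong-≗ (λ i → ∑-layoutOn ps eq (λ q → c (f i) q * c (f i) q)) ⟩
    ∑[ i < n ] weigh ps (λ q → c (f i) q * c (f i) q)
      ≡⟨ ∑-layoutOn ps eq (λ p → weigh ps (λ q → c p q * c p q)) ⟩
    weigh ps (λ p → weigh ps (λ q → c p q * c p q)) ∎
    where open ≡-Reasoning

∑codeg²-relabel : ∀ {n} (ψ : Fin n ↔ Fin n) (G : Graph3 (Fin n)) → ∑codeg² (relabel ψ G) ≡ ∑codeg² G
∑codeg²-relabel {n} ψ G = begin
  ∑[ i < n ] ∑[ j < n ] sq (∑[ k < n ] [ G (π i) (π j) (π k) ])
    ≡⟨ sum-cong-≗ (λ i → sum-cong-≗ (λ j → cong sq (∑-relabel ψ (λ k → [ G (π i) (π j) k ])))) ⟩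
  ∑[ i < n ] ∑[ j < n ] sq (codegree G (π i) (π j))
    ≡⟨ sum-cong-≗ (λ i → ∑-relabel ψ (λ j → sq (codegree G (π i) j))) ⟩
  ∑[ i < n ] ∑[ j < n ] sq (codegree G (π i) j)
    ≡⟨ ∑-relabel ψ (λ i → ∑[ j < n ] sq (codegree G i j)) ⟩
  ∑codeg² G ∎
  where
  open ≡-Reasoning
  π = Inverse.from ψ
  sq : ℕ → ℕ
  sq d = d * d

square-≤ : ∀ {n c d e} → c ≤ n → d ≤ n → c ≤ d + e → c * c ≤ d * d + 2 * n * e
square-≤ {n} {c} {d} {e} c≤n d≤n c≤d+e with ≤-total c d
... | inj₁ c≤d = ≤-trans (*-mono-≤ c≤d c≤d) (m≤m+n (d * d) _)
... | inj₂ d≤c with m≤n⇒∃[o]m+o≡n d≤c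
...   | t , refl = begin
  (d + t) * (d + t)         ≡⟨ expand d t ⟩
  d * d + t * (d + (d + t)) ≤⟨ +-monoʳ-≤ (d * d) (*-mono-≤ (+-cancelˡ-≤ d t e c≤d+e) (+-mono-≤ d≤n c≤n)) ⟩
  d * d + e * (n + n)       ≡⟨ cong (d * d +_) (twice e n) ⟩
  d * d + 2 * n * e         ∎
  where
  open ≤-Reasoning
  expand : ∀ d t → (d + t) * (d + t) ≡ d * d + t * (d + (d + t))
  expand = solve-∀
  twice : ∀ e n → e * (n + n) ≡ 2 * n * e
  twice = solve-∀

∑codeg²-lipschitz : ∀ {n} {G H : Graph3 (Fin n)} → Simple G → Simple H →
  ∑codeg² G ≤ ∑codeg² H + 12 * n * symDiff G H
∑codeg²-lipschitz {n} {G} {H} G-simple H-simple = begin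
  ∑codeg² G
    ≤⟨ ∑-mono-≤ (λ i → ∑-mono-≤ (λ j → square-≤ (∑[]≤n (G i j)) (∑[]≤n (H i j)) (codegree-≤ i j))) ⟩
  ∑[ i < n ] ∑[ j < n ] (codegree H i j * codegree H i j + 2 * n * D i j)
    ≡⟨ sum-cong-≗ (λ i → trans (∑-distrib-+ _ (λ j → 2 * n * D i j))
                                (cong (_ +_) (sym (*-distribˡ-sum (2 * n) (D i))))) ⟩
  ∑[ i < n ] (∑[ j < n ] (codegree H i j * codegree H i j) + 2 * n * ∑[ j < n ] D i j)
    ≡⟨ trans (∑-distrib-+ _ (λ i → 2 * n * ∑[ j < n ] D i j))
             (cong (_ +_) (sym (*-distribˡ-sum (2 * n) (λ i → ∑[ j < n ] D i j)))) ⟩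
  ∑codeg² H + 2 * n * ∑³ n (λ i j k → [ G i j k xor H i j k ])
    ≡⟨ cong (λ s → ∑codeg² H + 2 * n * s) (∑³[G]≡6*countTriples _ (xor-simple G-simple H-simple)) ⟩
  ∑codeg² H + 2 * n * (6 * symDiff G H)
    ≡⟨ cong (∑codeg² H +_) (regroup n (symDiff G H)) ⟩
  ∑codeg² H + 12 * n * symDiff G H ∎
  where
  open ≤-Reasoning
  D : Fin n → Fin n → ℕ
  D i j = ∑[ k < n ] [ G i j k xor H i j k ]
  codegree-≤ : ∀ i j → codegree G i j ≤ codegree H i j + D i j
  codegree-≤ i j = ≤-trans (∑-mono-≤ (λ k → []≤[]+[xor] (G i j k) (H i j k)))
    (≤-reflexive (∑-distrib-+ (λ k → [ H i j k ]) (λ k → [ G i j k xor H i j k ])))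
  regroup : ∀ n s → 2 * n * (6 * s) ≡ 12 * n * s
  regroup = solve-∀

balance-gap : ∀ {P Q u v g T} → P + u ≡ Q + v → v + g ≤ u → Q ≤ P + T → g ≤ T
balance-gap {P} {Q} {u} {v} {g} {T} balance gain Q≤P+T = +-cancelˡ-≤ (P + v) g T (begin
  P + v + g    ≡⟨ +-assoc P v g ⟩
  P + (v + g)  ≤⟨ +-monoʳ-≤ P gain ⟩
  P + u        ≡⟨ balance ⟩
  Q + v        ≤⟨ +-monoˡ-≤ v Q≤P+T ⟩
  P + T + v    ≡⟨ rearrange P T v ⟩
  P + v + T    ∎)
  where
  open ≤-Reasoning
  rearrange : ∀ P T v → P + T + v ≡ P + v + T
  rearrange = solve-∀

-- a-x and a-y are the vertices a_c of the two coordinate forms; uᵢⱼ is the vector (i, j).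
a-x a-y u₀₀ u₀₁ u₁₀ u₁₁ : TVertex 2 2
a-x = inj₁ zero
a-y = inj₁ (suc zero)
u₀₀ = inj₂ (false ∷ false ∷ [])
u₀₁ = inj₂ (false ∷ true ∷ [])
u₁₀ = inj₂ (true ∷ false ∷ [])
u₁₁ = inj₂ (true ∷ true ∷ [])

R×-parts : {A : Set} → A → A → A → A → List (TVertex 2 2 × A)
R×-parts y a b x = (a-y , y) ∷ (u₀₀ , a) ∷ (u₀₁ , b) ∷ (u₁₀ , b) ∷ (u₁₁ , a) ∷ (a-x , x) ∷ []

-- Both identities are checked by the ring solver on the same weighted sums built from
-- polynomials; evaluating those polynomials gives back the sums over ℕ definitionally.
module _ where
  open import Data.Nat.Solver using (module +-*-Solver)
  open +-*-Solver using (Polynomial; prove; con; var; _:+_; _:*_)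

  private
    polynomials : RawSemiring 0ℓ 0ℓ
    polynomials = record
      { Carrier = Polynomial 4 ; _≈_ = _≡_ ; _+_ = _:+_ ; _*_ = _:*_ ; 0# = con 0 ; 1# = con 1 }

    open Weighted polynomials using () renaming (weigh to weighᴾ)

    Y A B X : Polynomial 4
    Y = var zero
    A = var (suc zero)
    B = var (suc (suc zero))
    X = var (suc (suc (suc zero)))

    cᴾ : TVertex 2 2 → TVertex 2 2 → Polynomial 4
    cᴾ p q = weighᴾ (R×-parts Y A B X) (λ r → con [ Rtimes p q r ])

  R×-edges : ∀ y a b x → let ps = R×-parts y a b x ; c = weightedCodegree Rtimes ps in
    weigh ps (λ p → weigh ps (λ q → c p q)) ≡ 6 * ((x + y) * ((a + b) * (a + b)))
  R×-edges y a b x = prove (y ∷ a ∷ b ∷ x ∷ [])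
    (weighᴾ ps (λ p → weighᴾ ps (λ q → cᴾ p q)))
    (con 6 :* ((X :+ Y) :* ((A :+ B) :* (A :+ B))))
    refl
    where ps = R×-parts Y A B X

  R×-∑codeg² : ∀ y a b x → let ps = R×-parts y a b x ; c = weightedCodegree Rtimes ps in
    weigh ps (λ p → weigh ps (λ q → c p q * c p q)) + 8 * x * y * (a * b)
      ≡ 4 * (x + y) * ((a + b) * (a + b) * (a + b)) + 2 * ((x + y) * (x + y)) * ((a + b) * (a + b))
  R×-∑codeg² y a b x = prove (y ∷ a ∷ b ∷ x ∷ [])
    (weighᴾ ps (λ p → weighᴾ ps (λ q → cᴾ p q :* cᴾ p q)) :+ con 8 :* X :* Y :* (A :* B))
    (con 4 :* (X :+ Y) :* ((A :+ B) :* (A :+ B) :* (A :+ B)) :+ con 2 :* ((X :+ Y) :* (X :+ Y)) :* ((A :+ B) :* (A :+ B)))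
    refl
    where ps = R×-parts Y A B X

R×-sizes : ℕ → ℕ → List (TVertex 2 2 × ℕ)
R×-sizes n a = R×-parts h a (2 * h ∸ a) (h + n % 6)
  where h = n / 6

a+[2h∸a]≡2h : ∀ {a h} → a ≤ h → a + (2 * h ∸ a) ≡ 2 * h
a+[2h∸a]≡2h {a} {h} a≤h = m+[n∸m]≡n (≤-trans a≤h (m≤m+n h (h + 0)))

n≡total-R×-sizes : ∀ n a → a ≤ n / 6 → n ≡ total (R×-sizes n a)
n≡total-R×-sizes n a a≤h = begin
  n                                       ≡⟨ m≡m%n+[m/n]*n n 6 ⟩
  r + h * 6                               ≡⟨ split r h ⟩
  r + 2 * h + 2 * (2 * h)                 ≡⟨ cong (λ s → r + 2 * h + 2 * s) (a+[2h∸a]≡2h a≤h) ⟨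
  r + 2 * h + 2 * (a + b)                 ≡⟨ regroup r h a b ⟩
  h + (a + (b + (b + (a + (h + r + 0))))) ∎
  where
  open ≡-Reasoning
  h = n / 6
  r = n % 6
  b = 2 * h ∸ a
  split : ∀ r h → r + h * 6 ≡ r + 2 * h + 2 * (2 * h)
  split = solve-∀
  regroup : ∀ r h a b → r + 2 * h + 2 * (a + b) ≡ h + (a + (b + (b + (a + (h + r + 0)))))
  regroup = solve-∀

R×-partition : ∀ n a → a ≤ n / 6 → Fin n → TVertex 2 2
R×-partition n a a≤h = layoutOn (R×-sizes n a) (n≡total-R×-sizes n a a≤h)

R×-graph : ∀ n a → a ≤ n / 6 → Graph3 (Fin n)
R×-graph n a a≤h = blowup Rtimes (R×-partition n a a≤h)

size-R×-graph : ∀ n a (a≤h : a ≤ n / 6) → let h = n / 6 in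
  size (R×-graph n a a≤h) ≡ (h + n % 6 + h) * (2 * h * (2 * h))
size-R×-graph n a a≤h = *-cancelˡ-≡ _ _ 6 (begin
  6 * size (R×-graph n a a≤h)
    ≡⟨ 6*size-blowup Rtimes ps (n≡total-R×-sizes n a a≤h) (cutTemplate-simple _) ⟩
  weigh ps (λ p → weigh ps (λ q → weightedCodegree Rtimes ps p q))
    ≡⟨ R×-edges h a (2 * h ∸ a) x ⟩
  6 * ((x + h) * ((a + (2 * h ∸ a)) * (a + (2 * h ∸ a))))
    ≡⟨ cong (λ s → 6 * ((x + h) * (s * s))) (a+[2h∸a]≡2h a≤h) ⟩
  6 * ((x + h) * (2 * h * (2 * h))) ∎)
  where
  open ≡-Reasoning
  h = n / 6
  x = h + n % 6
  ps = R×-sizes n a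

∑codeg²-R×-balance : ∀ n a a′ (a≤h : a ≤ n / 6) (a′≤h : a′ ≤ n / 6) →
  let h = n / 6 ; c = 8 * (h + n % 6) * h in
  ∑codeg² (R×-graph n a a≤h) + c * (a * (2 * h ∸ a)) ≡ ∑codeg² (R×-graph n a′ a′≤h) + c * (a′ * (2 * h ∸ a′))
∑codeg²-R×-balance n a a′ a≤h a′≤h = trans (independent a a≤h) (sym (independent a′ a′≤h))
  where
  h = n / 6
  x = h + n % 6
  independent : ∀ a (a≤h : a ≤ h) → ∑codeg² (R×-graph n a a≤h) + 8 * x * h * (a * (2 * h ∸ a))
    ≡ 4 * (x + h) * (2 * h * (2 * h) * (2 * h)) + 2 * ((x + h) * (x + h)) * (2 * h * (2 * h))
  independent a a≤h = begin
    ∑codeg² (R×-graph n a a≤h) + 8 * x * h * (a * b)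
      ≡⟨ cong (_+ 8 * x * h * (a * b)) (∑codeg²-blowup Rtimes ps (n≡total-R×-sizes n a a≤h)) ⟩
    weigh ps (λ p → weigh ps (λ q → c p q * c p q)) + 8 * x * h * (a * b)
      ≡⟨ R×-∑codeg² h a b x ⟩
    4 * (x + h) * ((a + b) * (a + b) * (a + b)) + 2 * ((x + h) * (x + h)) * ((a + b) * (a + b))
      ≡⟨ cong (λ s → 4 * (x + h) * (s * s * s) + 2 * ((x + h) * (x + h)) * (s * s)) (a+[2h∸a]≡2h a≤h) ⟩
    4 * (x + h) * (2 * h * (2 * h) * (2 * h)) + 2 * ((x + h) * (x + h)) * (2 * h * (2 * h)) ∎
    where
    open ≡-Reasoning
    b = 2 * h ∸ a
    ps = R×-sizes n a
    c = weightedCodegree Rtimes ps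

m≡o+n⇒m∸o≡n : ∀ {m n o} → m ≡ o + n → m ∸ o ≡ n
m≡o+n⇒m∸o≡n {n = n} {o} refl = m+n∸m≡n o n

-- With a = a′ + δ and h = a + e both products are polynomials, differing by δ² + 2eδ.
product-gap : ∀ {h a a′} → a′ ≤ a → a ≤ h → a′ * (2 * h ∸ a′) + (a ∸ a′) * (a ∸ a′) ≤ a * (2 * h ∸ a)
product-gap {a′ = a′} a′≤a a≤h with m≤n⇒∃[o]m+o≡n a′≤a | m≤n⇒∃[o]m+o≡n a≤h
... | δ , refl | e , refl = begin
  a′ * (2 * h ∸ a′) + (a′ + δ ∸ a′) * (a′ + δ ∸ a′)
    ≡⟨ cong₂ (λ u v → a′ * u + v * v) (m≡o+n⇒m∸o≡n {o = a′} (twice₁ a′ δ e)) (m+n∸m≡n a′ δ) ⟩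
  a′ * (a′ + 2 * δ + 2 * e) + δ * δ
    ≤⟨ m≤m+n _ (2 * e * δ) ⟩
  a′ * (a′ + 2 * δ + 2 * e) + δ * δ + 2 * e * δ
    ≡⟨ expand a′ δ e ⟩
  (a′ + δ) * (a′ + δ + 2 * e)
    ≡⟨ cong ((a′ + δ) *_) (m≡o+n⇒m∸o≡n {o = a′ + δ} (twice₂ a′ δ e)) ⟨
  (a′ + δ) * (2 * h ∸ (a′ + δ)) ∎
  where
  open ≤-Reasoning
  h = a′ + δ + e
  twice₁ : ∀ a′ δ e → 2 * (a′ + δ + e) ≡ a′ + (a′ + 2 * δ + 2 * e)
  twice₁ = solve-∀
  twice₂ : ∀ a′ δ e → 2 * (a′ + δ + e) ≡ (a′ + δ) + (a′ + δ + 2 * e)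
  twice₂ = solve-∀
  expand : ∀ a′ δ e → a′ * (a′ + 2 * δ + 2 * e) + δ * δ + 2 * e * δ ≡ (a′ + δ) * (a′ + δ + 2 * e)
  expand = solve-∀

R×-distance : ∀ n a a′ (a≤h : a ≤ n / 6) (a′≤h : a′ ≤ n / 6) (ψ : Fin n ↔ Fin n) → let h = n / 6 in
  8 * (h + n % 6) * h * (∣ a - a′ ∣ * ∣ a - a′ ∣)
    ≤ 12 * n * symDiff (relabel ψ (R×-graph n a a≤h)) (R×-graph n a′ a′≤h)
R×-distance n a a′ a≤h a′≤h ψ = by-order (≤-total a′ a)
  where
  h = n / 6
  c = 8 * (h + n % 6) * h
  G H : Graph3 (Fin n)
  G = R×-graph n a a≤h
  H = R×-graph n a′ a′≤h
  T = 12 * n * symDiff (relabel ψ G) H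
  simple : ∀ {a} (a≤h : a ≤ h) → Simple (R×-graph n a a≤h)
  simple {a} a≤h = blowup-simple (R×-partition n a a≤h) (cutTemplate-simple _)
  gain : ∀ {a a′} → a′ ≤ a → a ≤ h →
    c * (a′ * (2 * h ∸ a′)) + c * ((a ∸ a′) * (a ∸ a′)) ≤ c * (a * (2 * h ∸ a))
  gain a′≤a a≤h = ≤-trans (≤-reflexive (sym (*-distribˡ-+ c _ _))) (*-monoʳ-≤ c (product-gap a′≤a a≤h))
  E≤E′+T : ∑codeg² G ≤ ∑codeg² H + T
  E≤E′+T = subst (_≤ ∑codeg² H + T) (∑codeg²-relabel ψ G)
    (∑codeg²-lipschitz (relabel-simple ψ (simple a≤h)) (simple a′≤h))
  E′≤E+T : ∑codeg² H ≤ ∑codeg² G + T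
  E′≤E+T = subst₂ (λ E s → ∑codeg² H ≤ E + 12 * n * s) (∑codeg²-relabel ψ G) (symDiff-comm H (relabel ψ G))
    (∑codeg²-lipschitz (simple a′≤h) (relabel-simple ψ (simple a≤h)))
  by-order : a′ ≤ a ⊎ a ≤ a′ → c * (∣ a - a′ ∣ * ∣ a - a′ ∣) ≤ T
  by-order (inj₁ a′≤a) = subst (λ δ → c * (δ * δ) ≤ T) (sym (trans (∣-∣-comm a a′) (m≤n⇒∣m-n∣≡n∸m a′≤a)))
    (balance-gap (∑codeg²-R×-balance n a a′ a≤h a′≤h) (gain a′≤a a≤h) E′≤E+T)
  by-order (inj₂ a≤a′) = subst (λ δ → c * (δ * δ) ≤ T) (sym (m≤n⇒∣m-n∣≡n∸m a≤a′))
    (balance-gap (sym (∑codeg²-R×-balance n a a′ a≤h a′≤h)) (gain a≤a′ a′≤h) E≤E′+T)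

n≤n*n : ∀ n → n ≤ n * n
n≤n*n zero = z≤n
n≤n*n (suc n) = m≤m*n (suc n) (suc n)

-- The ring solver does not handle ℕ's _^_, so cubes are expanded before solving.
n³≡n*[n*n] : ∀ n → n ^ 3 ≡ n * (n * n)
n³≡n*[n*n] n = cong (λ k → n * (n * k)) (*-identityʳ n)

n≤n³ : ∀ n → n ≤ n ^ 3
n≤n³ n = ≤-trans (n≤n*n n) (≤-trans (*-monoʳ-≤ n (n≤n*n n)) (≤-reflexive (sym (n³≡n*[n*n] n))))

2*nC2+n≡n² : ∀ n → 2 * (n C 2) + n ≡ n * n
2*nC2+n≡n² zero = refl
2*nC2+n≡n² (suc n) = begin
  2 * (suc n C 2) + suc n         ≡⟨ cong (λ c → 2 * c + suc n) (nCk+nC[k+1]≡[n+1]C[k+1] n 1) ⟨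
  2 * (n C 1 + n C 2) + suc n     ≡⟨ cong (λ c → 2 * (c + n C 2) + suc n) (nC1≡n n) ⟩
  2 * (n + n C 2) + suc n         ≡⟨ step₁ n (n C 2) ⟩
  (2 * (n C 2) + n) + (2 * n + 1) ≡⟨ cong (_+ (2 * n + 1)) (2*nC2+n≡n² n) ⟩
  n * n + (2 * n + 1)             ≡⟨ step₂ n ⟩
  suc n * suc n                   ∎
  where
  open ≡-Reasoning
  step₁ : ∀ n c → 2 * (n + c) + (1 + n) ≡ (2 * c + n) + (2 * n + 1)
  step₁ = solve-∀
  step₂ : ∀ n → n * n + (2 * n + 1) ≡ (1 + n) * (1 + n)
  step₂ = solve-∀

6*nC3+3n²≡n³+2n : ∀ n → 6 * (n C 3) + 3 * (n * n) ≡ n * (n * n) + 2 * n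
6*nC3+3n²≡n³+2n zero = refl
6*nC3+3n²≡n³+2n (suc n) = +-cancelʳ-≡ (3 * n) _ _ (begin
  6 * (suc n C 3) + 3 * (suc n * suc n) + 3 * n
    ≡⟨ cong (λ c → 6 * c + 3 * (suc n * suc n) + 3 * n) (nCk+nC[k+1]≡[n+1]C[k+1] n 2) ⟨
  6 * (n C 2 + n C 3) + 3 * (suc n * suc n) + 3 * n
    ≡⟨ step₁ n (n C 2) (n C 3) ⟩
  (6 * (n C 3) + 3 * (n * n)) + 3 * (2 * (n C 2) + n) + (6 * n + 3)
    ≡⟨ cong₂ (λ u v → u + 3 * v + (6 * n + 3)) (6*nC3+3n²≡n³+2n n) (2*nC2+n≡n² n) ⟩
  (n * (n * n) + 2 * n) + 3 * (n * n) + (6 * n + 3)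
    ≡⟨ step₂ n ⟩
  suc n * (suc n * suc n) + 2 * suc n + 3 * n ∎)
  where
  open ≡-Reasoning
  step₁ : ∀ n c₂ c₃ → 6 * (c₂ + c₃) + 3 * ((1 + n) * (1 + n)) + 3 * n
                     ≡ (6 * c₃ + 3 * (n * n)) + 3 * (2 * c₂ + n) + (6 * n + 3)
  step₁ = solve-∀
  step₂ : ∀ n → (n * (n * n) + 2 * n) + 3 * (n * n) + (6 * n + 3) ≡ (1 + n) * ((1 + n) * (1 + n)) + 2 * (1 + n) + 3 * n
  step₂ = solve-∀

∣+m-+n∣≤o : ∀ {m n o} → m ≤ n + o → n ≤ m + o → ℤ.∣ ℤ.+ m ℤ.- ℤ.+ n ∣ ≤ o
∣+m-+n∣≤o {m} {n} {o} m≤n+o n≤m+o rewrite ℤ.m-n≡m⊖n m n with ≤-total m n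
... | inj₁ m≤n = subst (_≤ o) (sym (ℤ.∣⊖∣-≤ m≤n)) (m≤n+o⇒m∸n≤o n m n≤m+o)
... | inj₂ n≤m = subst (_≤ o) (sym (trans (ℤ.∣m⊖n∣≡∣n⊖m∣ m n) (ℤ.∣⊖∣-≤ n≤m))) (m≤n+o⇒m∸n≤o m n m≤n+o)

eventually-negligible : ∀ (err B : ℕ → ℕ) K L .{{_ : NonZero L}} →
  (∀ n → err n ≤ K * (n * n)) → (∀ n → n ^ 3 ≤ L * B n + L * (n * n)) →
  ∀ m → ∃[ N ] ∀ n → N ≤ n → suc m * err n ≤ B n
eventually-negligible err B K L err≤ n³≤ m = L * (suc m * K) + L , λ n N≤n →
  *-cancelˡ-≤ L (+-cancelʳ-≤ (L * (n * n)) _ _ (begin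
    L * (suc m * err n) + L * (n * n)         ≤⟨ +-monoˡ-≤ (L * (n * n)) (*-monoʳ-≤ L (*-monoʳ-≤ (suc m) (err≤ n))) ⟩
    L * (suc m * (K * (n * n))) + L * (n * n) ≡⟨ regroup L (suc m) K (n * n) ⟩
    (L * (suc m * K) + L) * (n * n)           ≤⟨ *-monoˡ-≤ (n * n) N≤n ⟩
    n * (n * n)                               ≡⟨ n³≡n*[n*n] n ⟨
    n ^ 3                                     ≤⟨ n³≤ n ⟩
    L * B n + L * (n * n)                     ∎))
  where
  open ≤-Reasoning
  regroup : ∀ L s K x → L * (s * (K * x)) + L * x ≡ (L * (s * K) + L) * x
  regroup = solve-∀

module _ (e : ℕ → ℕ) (K : ℕ)
         (27e≤n³ : ∀ n → 27 * e n ≤ n ^ 3) (n³≤27e+Kn² : ∀ n → n ^ 3 ≤ 27 * e n + K * (n * n)) where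

  edgesAsymp-intro : EdgesAsymp e
  edgesAsymp-intro = eventually-negligible (λ n → ℤ.∣ ℤ.+ (27 * e n) ℤ.- ℤ.+ (n ^ 3) ∣) (λ n → n ^ 3) K 1
    (λ n → ∣+m-+n∣≤o (≤-trans (27e≤n³ n) (m≤m+n _ _)) (n³≤27e+Kn² n))
    (λ n → ≤-trans (m≤m+n (n ^ 3) (n * n)) (≤-reflexive (sym (cong₂ _+_ (*-identityˡ (n ^ 3)) (*-identityˡ (n * n))))))

  edgesAsympBinom-intro : EdgesAsympBinom e
  edgesAsympBinom-intro =
    eventually-negligible (λ n → ℤ.∣ ℤ.+ (9 * e n) ℤ.- ℤ.+ (2 * (n C 3)) ∣) (λ n → 2 * (n C 3)) (K + 3) 3
    (λ n → ≤-trans (∣+m-+n∣≤o (9e≤ n) (2C≤ n)) (error≤ n))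
    n³≤
    where
    open ≤-Reasoning
    factor₁ : ∀ c s → 6 * c + 3 * s ≡ 3 * (2 * c + s)
    factor₁ = solve-∀
    factor₂ : ∀ e s t → 27 * e + s + t ≡ 3 * (9 * e) + (s + t)
    factor₂ = solve-∀
    factor₃ : ∀ K s → K * s + 2 * s + s ≡ (K + 3) * s
    factor₃ = solve-∀
    9e≤ : ∀ n → 9 * e n ≤ 2 * (n C 3) + (K * (n * n) + 2 * n + n * n)
    9e≤ n = *-cancelˡ-≤ 3 (begin
      3 * (9 * e n)                     ≡⟨ *-assoc 3 9 (e n) ⟨
      27 * e n                          ≤⟨ 27e≤n³ n ⟩
      n ^ 3                             ≡⟨ n³≡n*[n*n] n ⟩
      n * (n * n)                       ≤⟨ m≤m+n _ (2 * n) ⟩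
      n * (n * n) + 2 * n               ≡⟨ 6*nC3+3n²≡n³+2n n ⟨
      6 * (n C 3) + 3 * (n * n)         ≡⟨ factor₁ (n C 3) (n * n) ⟩
      3 * (2 * (n C 3) + n * n)         ≤⟨ *-monoʳ-≤ 3 (+-monoʳ-≤ (2 * (n C 3)) (m≤n+m (n * n) _)) ⟩
      3 * (2 * (n C 3) + (K * (n * n) + 2 * n + n * n)) ∎)
    2C≤ : ∀ n → 2 * (n C 3) ≤ 9 * e n + (K * (n * n) + 2 * n + n * n)
    2C≤ n = *-cancelˡ-≤ 3 (begin
      3 * (2 * (n C 3))                 ≤⟨ ≤-trans (≤-reflexive (sym (*-assoc 3 2 (n C 3)))) (m≤m+n _ _) ⟩
      6 * (n C 3) + 3 * (n * n)         ≡⟨ 6*nC3+3n²≡n³+2n n ⟩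
      n * (n * n) + 2 * n               ≡⟨ cong (_+ 2 * n) (n³≡n*[n*n] n) ⟨
      n ^ 3 + 2 * n                     ≤⟨ +-monoˡ-≤ (2 * n) (n³≤27e+Kn² n) ⟩
      27 * e n + K * (n * n) + 2 * n    ≡⟨ factor₂ (e n) (K * (n * n)) (2 * n) ⟩
      3 * (9 * e n) + (K * (n * n) + 2 * n)
        ≤⟨ +-monoʳ-≤ (3 * (9 * e n)) (≤-trans (m≤m+n _ (n * n)) (m≤n*m _ 3)) ⟩
      3 * (9 * e n) + 3 * (K * (n * n) + 2 * n + n * n)
        ≡⟨ *-distribˡ-+ 3 (9 * e n) _ ⟨
      3 * (9 * e n + (K * (n * n) + 2 * n + n * n)) ∎)
    error≤ : ∀ n → K * (n * n) + 2 * n + n * n ≤ (K + 3) * (n * n)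
    error≤ n = begin
      K * (n * n) + 2 * n + n * n       ≤⟨ +-monoˡ-≤ (n * n) (+-monoʳ-≤ (K * (n * n)) (*-monoʳ-≤ 2 (n≤n*n n))) ⟩
      K * (n * n) + 2 * (n * n) + n * n ≡⟨ factor₃ K (n * n) ⟩
      (K + 3) * (n * n)                 ∎
    n³≤ : ∀ n → n ^ 3 ≤ 3 * (2 * (n C 3)) + 3 * (n * n)
    n³≤ n = begin
      n ^ 3                             ≡⟨ n³≡n*[n*n] n ⟩
      n * (n * n)                       ≤⟨ m≤m+n _ (2 * n) ⟩
      n * (n * n) + 2 * n               ≡⟨ 6*nC3+3n²≡n³+2n n ⟨
      6 * (n C 3) + 3 * (n * n)         ≡⟨ cong (_+ 3 * (n * n)) (*-assoc 3 2 (n C 3)) ⟩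
      3 * (2 * (n C 3)) + 3 * (n * n)   ∎

-- With n = 6h + r, 27 (2h + r)(2h)² falls short of (6h + r)³ by exactly this.
cube-defect : ℕ → ℕ
cube-defect n = 18 * (r * r) * h + r * (r * r)
  where
  h = n / 6
  r = n % 6

27*size-R×+defect≡n³ : ∀ n a (a≤h : a ≤ n / 6) → 27 * size (R×-graph n a a≤h) + cube-defect n ≡ n ^ 3
27*size-R×+defect≡n³ n a a≤h = begin
  27 * size (R×-graph n a a≤h) + cube-defect n
    ≡⟨ cong (λ e → 27 * e + cube-defect n) (size-R×-graph n a a≤h) ⟩
  27 * ((h + r + h) * (2 * h * (2 * h))) + (18 * (r * r) * h + r * (r * r))
    ≡⟨ cube h r ⟩
  (r + h * 6) * ((r + h * 6) * (r + h * 6))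
    ≡⟨ cong (λ m → m * (m * m)) (m≡m%n+[m/n]*n n 6) ⟨
  n * (n * n)
    ≡⟨ n³≡n*[n*n] n ⟨
  n ^ 3 ∎
  where
  open ≡-Reasoning
  h = n / 6
  r = n % 6
  cube : ∀ h r → 27 * ((h + r + h) * (2 * h * (2 * h))) + (18 * (r * r) * h + r * (r * r))
                 ≡ (r + h * 6) * ((r + h * 6) * (r + h * 6))
  cube = solve-∀

cube-defect≤ : ∀ n → cube-defect n ≤ 475 * (n * n)
cube-defect≤ n = begin
  18 * (r * r) * h + r * (r * r)
    ≤⟨ +-mono-≤ (*-mono-≤ (*-monoʳ-≤ 18 r²≤25) (m/n≤m n 6)) (*-mono-≤ (m%n≤m n 6) r²≤25) ⟩
  18 * 25 * n + n * 25           ≡⟨ collect n ⟩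
  475 * n                        ≤⟨ *-monoʳ-≤ 475 (n≤n*n n) ⟩
  475 * (n * n)                  ∎
  where
  open ≤-Reasoning
  h = n / 6
  r = n % 6
  r²≤25 : r * r ≤ 25
  r²≤25 = *-mono-≤ (s≤s⁻¹ (m%n<n n 6)) (s≤s⁻¹ (m%n<n n 6))
  collect : ∀ n → 18 * 25 * n + n * 25 ≡ 475 * n
  collect = solve-∀

R×-edge-asymptotics : ∀ (a : ℕ → ℕ) (a≤h : ∀ n → a n ≤ n / 6) → let e = λ n → size (R×-graph n (a n) (a≤h n)) in
  EdgesAsymp e × EdgesAsympBinom e
R×-edge-asymptotics a a≤h = edgesAsymp-intro e 475 27e≤n³ n³≤27e+475n² , edgesAsympBinom-intro e 475 27e≤n³ n³≤27e+475n²
  where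
  e = λ n → size (R×-graph n (a n) (a≤h n))
  27e≤n³ : ∀ n → 27 * e n ≤ n ^ 3
  27e≤n³ n = ≤-trans (m≤m+n _ (cube-defect n)) (≤-reflexive (27*size-R×+defect≡n³ n (a n) (a≤h n)))
  n³≤27e+475n² : ∀ n → n ^ 3 ≤ 27 * e n + 475 * (n * n)
  n³≤27e+475n² n = ≤-trans (≤-reflexive (sym (27*size-R×+defect≡n³ n (a n) (a≤h n))))
                           (+-monoʳ-≤ (27 * e n) (cube-defect≤ n))

m≤2n*[m/n] : ∀ {m n} .{{_ : NonZero n}} → n ≤ m → m ≤ 2 * n * (m / n)
m≤2n*[m/n] {m} {n} n≤m = begin
  m               ≡⟨ m≡m%n+[m/n]*n m n ⟩
  m % n + q * n   ≤⟨ +-monoˡ-≤ (q * n) (<⇒≤ (m%n<n m n)) ⟩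
  n + q * n       ≤⟨ +-monoˡ-≤ (q * n) (m≤n*m n q {{>-nonZero (m≥n⇒m/n>0 n≤m)}}) ⟩
  q * n + q * n   ≡⟨ double q n ⟩
  2 * n * q       ∎
  where
  open ≤-Reasoning
  q = m / n
  double : ∀ q n → q * n + q * n ≡ 2 * n * q
  double = solve-∀

-- The witness is d = n³ / K: it lies below every symDiff, and n³ ≤ 2K d once n³ ≥ K.
distOmegaCube-intro : ∀ {G H : (n : ℕ) → Graph3 (Fin n)} K N .{{_ : NonZero K}} →
  (∀ n → N ≤ n → ∀ ψ → n ^ 3 ≤ K * symDiff (relabel ψ (G n)) (H n)) → DistOmegaCube G H
distOmegaCube-intro K N bound = 2 * K , N + K , λ n N+K≤n →
  n ^ 3 / K ,
  m≤2n*[m/n] (≤-trans (≤-trans (m≤n+m K N) N+K≤n) (n≤n³ n)) ,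
  λ ψ → ≤-trans (/-monoˡ-≤ K (≤-trans (bound n (≤-trans (m≤m+n N K) N+K≤n) ψ) (≤-reflexive (*-comm K _))))
                (≤-reflexive (m*n/n≡m _ K))

-- Cancelling h leaves h³ ≤ 84 M² s, and n³ ≤ 7³ h³; hence 28812 = 7³ · 84.
cubic-bound : ∀ {n h x δ M s} → 1 ≤ h → h ≤ x → n ≤ 7 * h → h ≤ M * δ →
  8 * x * h * (δ * δ) ≤ 12 * n * s → n ^ 3 ≤ 28812 * (M * M) * s
cubic-bound {n} {h@(suc _)} {x} {δ} {M} {s} _ h≤x n≤7h h≤Mδ gap = begin
  n ^ 3                     ≡⟨ n³≡n*[n*n] n ⟩
  n * (n * n)               ≤⟨ *-mono-≤ n≤7h (*-mono-≤ n≤7h n≤7h) ⟩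
  7 * h * (7 * h * (7 * h)) ≡⟨ cube₇ h ⟩
  343 * (h * (h * h))       ≤⟨ *-monoʳ-≤ 343 h³≤ ⟩
  343 * (84 * (M * M) * s)  ≡⟨ constants M s ⟩
  28812 * (M * M) * s       ∎
  where
  open ≤-Reasoning
  cube₇ : ∀ h → 7 * h * (7 * h * (7 * h)) ≡ 343 * (h * (h * h))
  cube₇ = solve-∀
  constants : ∀ M s → 343 * (84 * (M * M) * s) ≡ 28812 * (M * M) * s
  constants = solve-∀
  shuffle₁ : ∀ h → h * (8 * (h * (h * h))) ≡ 8 * h * h * (h * h)
  shuffle₁ = solve-∀
  shuffle₂ : ∀ x h M δ → 8 * x * h * (M * δ * (M * δ)) ≡ M * M * (8 * x * h * (δ * δ))
  shuffle₂ = solve-∀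
  shuffle₃ : ∀ M h s → M * M * (12 * (7 * h) * s) ≡ h * (84 * (M * M) * s)
  shuffle₃ = solve-∀
  h³≤ : h * (h * h) ≤ 84 * (M * M) * s
  h³≤ = ≤-trans (m≤n*m (h * (h * h)) 8) (*-cancelˡ-≤ h (begin
    h * (8 * (h * (h * h)))            ≡⟨ shuffle₁ h ⟩
    8 * h * h * (h * h)                ≤⟨ *-mono-≤ (*-monoˡ-≤ h (*-monoʳ-≤ 8 h≤x)) (*-mono-≤ h≤Mδ h≤Mδ) ⟩
    8 * x * h * (M * δ * (M * δ))      ≡⟨ shuffle₂ x h M δ ⟩
    M * M * (8 * x * h * (δ * δ))      ≤⟨ *-monoʳ-≤ (M * M) gap ⟩
    M * M * (12 * n * s)               ≤⟨ *-monoʳ-≤ (M * M) (*-monoˡ-≤ s (*-monoʳ-≤ 12 n≤7h)) ⟩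
    M * M * (12 * (7 * h) * s)         ≡⟨ shuffle₃ M h s ⟩
    h * (84 * (M * M) * s)             ∎))

n≤7*[n/6] : ∀ {n} → 30 ≤ n → n ≤ 7 * (n / 6)
n≤7*[n/6] {n} 30≤n = begin
  n                 ≡⟨ m≡m%n+[m/n]*n n 6 ⟩
  n % 6 + n / 6 * 6 ≤⟨ +-monoˡ-≤ (n / 6 * 6) (≤-trans (s≤s⁻¹ (m%n<n n 6)) (/-monoˡ-≤ 6 30≤n)) ⟩
  n / 6 + n / 6 * 6 ≡⟨ seven (n / 6) ⟩
  7 * (n / 6)       ∎
  where
  open ≤-Reasoning
  seven : ∀ h → h + h * 6 ≡ 7 * h
  seven = solve-∀

R×-distOmegaCube : ∀ (a a′ : ℕ → ℕ) (a≤h : ∀ n → a n ≤ n / 6) (a′≤h : ∀ n → a′ n ≤ n / 6) M N →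
  (∀ n → N ≤ n → n / 6 ≤ M * ∣ a n - a′ n ∣) →
  DistOmegaCube (λ n → R×-graph n (a n) (a≤h n)) (λ n → R×-graph n (a′ n) (a′≤h n))
-- The constant is made a successor only to provide the NonZero instance.
R×-distOmegaCube a a′ a≤h a′≤h M N separated = distOmegaCube-intro {G = G} {H} (suc (28812 * (M * M))) (N + 30) bound
  where
  G H : (n : ℕ) → Graph3 (Fin n)
  G n = R×-graph n (a n) (a≤h n)
  H n = R×-graph n (a′ n) (a′≤h n)
  bound : ∀ n → N + 30 ≤ n → ∀ ψ → n ^ 3 ≤ suc (28812 * (M * M)) * symDiff (relabel ψ (G n)) (H n)
  bound n N+30≤n ψ = ≤-trans
    (cubic-bound {M = M} 1≤h (m≤m+n (n / 6) (n % 6)) (n≤7*[n/6] 30≤n) (separated n (≤-trans (m≤m+n N 30) N+30≤n))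
      (R×-distance n (a n) (a′ n) (a≤h n) (a′≤h n) ψ))
    (*-monoˡ-≤ _ (n≤1+n (28812 * (M * M))))
    where
    30≤n : 30 ≤ n
    30≤n = ≤-trans (m≤n+m 30 N) N+30≤n
    1≤h : 1 ≤ n / 6
    1≤h = ≤-trans (s≤s z≤n) (/-monoˡ-≤ 6 30≤n)

-- Unifying frac k m against metavariables makes Agda normalise ℚ._/_ on open terms, which
-- blows up; hence the explicit implicit arguments to the frac lemmas below.
frac : ℕ → ℕ → ℚ
frac k m = ℤ.+ k ℚ./ suc m

private
  frac≃ : ∀ k m → ℚ.toℚᵘ (frac k m) ℚᵘ.≃ ℚᵘ.mkℚᵘ (ℤ.+ k) m
  frac≃ k m = ℚ.toℚᵘ-fromℚᵘ (ℚᵘ.mkℚᵘ (ℤ.+ k) m)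

frac-≤ : ∀ {a b c d} → a * suc d ≤ c * suc b → frac a b ℚ.≤ frac c d
frac-≤ {a} {b} {c} {d} ad≤cb = ℚ.toℚᵘ-cancel-≤
  (ℚᵘ.≤-respˡ-≃ (ℚᵘ.≃-sym (frac≃ a b)) (ℚᵘ.≤-respʳ-≃ (ℚᵘ.≃-sym (frac≃ c d))
    (ℚᵘ.*≤* (subst₂ ℤ._≤_ (ℤ.pos-* a (suc d)) (ℤ.pos-* c (suc b)) (ℤ.+≤+ ad≤cb)))))

frac-+ : ∀ a c m → frac a m ℚ.+ frac c m ≡ frac (a + c) m
frac-+ a c m = ℚ.toℚᵘ-injective (ℚᵘ.≃-trans (ℚ.toℚᵘ-homo-+ (frac a m) (frac c m))
  (ℚᵘ.≃-trans (ℚᵘ.+-cong (frac≃ a m) (frac≃ c m)) (ℚᵘ.≃-trans same-denominator (ℚᵘ.≃-sym (frac≃ (a + c) m)))))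
  where
  distrib : ∀ A C M → (A ℤ.* M ℤ.+ C ℤ.* M) ℤ.* M ≡ (A ℤ.+ C) ℤ.* (M ℤ.* M)
  distrib = ℤ-solve-∀
  same-denominator : ℚᵘ.mkℚᵘ (ℤ.+ a) m ℚᵘ.+ ℚᵘ.mkℚᵘ (ℤ.+ c) m ℚᵘ.≃ ℚᵘ.mkℚᵘ (ℤ.+ (a + c)) m
  same-denominator = ℚᵘ.*≡* (trans (distrib (ℤ.+ a) (ℤ.+ c) (ℤ.+ suc m))
    (cong₂ ℤ._*_ (sym (ℤ.pos-+ a c)) (sym (ℤ.pos-* (suc m) (suc m)))))

≤-add : ∀ {p q p′ q′} r → p ℚ.≤ q → p ℚ.+ r ≡ p′ → q ℚ.+ r ≡ q′ → p′ ℚ.≤ q′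
≤-add r p≤q refl refl = ℚ.+-monoˡ-≤ r p≤q

<-add : ∀ {p q p′ q′} r → p ℚ.< q → p ℚ.+ r ≡ p′ → q ℚ.+ r ≡ q′ → p′ ℚ.< q′
<-add r p<q refl refl = ℚ.+-monoˡ-< r p<q

p≤∣p∣ : ∀ p → p ℚ.≤ ℚ.∣ p ∣
p≤∣p∣ p with ℚ.∣p∣≡p∨∣p∣≡-p p
... | inj₁ ∣p∣≡p = ℚ.≤-reflexive (sym ∣p∣≡p)
... | inj₂ ∣p∣≡-p = ℚ.≤-trans p≤0 (ℚ.0≤∣p∣ p)
  where
  p≤0 : p ℚ.≤ 0ℚ
  p≤0 = ≤-add p (subst (0ℚ ℚ.≤_) ∣p∣≡-p (ℚ.0≤∣p∣ p)) (ℚ.+-identityˡ p) (ℚ.+-inverseˡ p)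

frac-monoˡ-≤ : ∀ {a c} m → a ≤ c → frac a m ℚ.≤ frac c m
frac-monoˡ-≤ {a} {c} m a≤c = frac-≤ {a} {m} {c} {m} (*-monoˡ-≤ (suc m) a≤c)

½<1 : ½ ℚ.< 1ℚ
½<1 = ℚ.*<* (ℤ.+<+ (s≤s (s≤s z≤n)))

archimedean : ∀ k {ε} → 0ℚ ℚ.< ε → ∃[ K ] frac k K ℚ.≤ ε
archimedean k {ε@(mkℚ (ℤ.+ suc p) d _)} _ = K , subst (frac k K ℚ.≤_) (ℚ.↥p/↧p≡p ε) (frac-≤ {k} {K} {suc p} {d} k*sd≤)
  where
  K = k * suc d
  k*sd≤ : k * suc d ≤ suc p * suc K
  k*sd≤ = ≤-trans (n≤1+n K) (m≤n*m (suc K) (suc p))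
archimedean k {mkℚ (ℤ.+ zero) _ _} 0<ε with ℚ.positive 0<ε
... | ()
archimedean k {mkℚ ℤ.-[1+ _ ] _ _} 0<ε with ℚ.positive 0<ε
... | ()

isYes-true : ∀ {A : Set} (a? : Dec A) → A → isYes a? ≡ true
isYes-true a? a = trans (isYes≗does a?) (dec-true a? a)

isYes-false : ∀ {A : Set} (a? : Dec A) → ¬ A → isYes a? ≡ false
isYes-false a? ¬a = trans (isYes≗does a?) (dec-false a? ¬a)

count : (ℕ → Bool) → ℕ → ℕ
count P zero = 0
count P (suc k) = count P k + [ P k ]

count≤ : ∀ P k → count P k ≤ k
count≤ P zero = z≤n
count≤ P (suc k) = ≤-trans (+-mono-≤ (count≤ P k) ([]≤1 (P k))) (≤-reflexive (+-comm k 1))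

≤-count : ∀ {P m} k → (∀ j → j < m → P j ≡ true) → m ≤ k → m ≤ count P k
≤-count zero all z≤n = z≤n
≤-count {P} (suc k) all m≤1+k with m≤n⇒m<n∨m≡n m≤1+k
... | inj₁ (s≤s m≤k) = ≤-trans (≤-count k all m≤k) (m≤m+n (count P k) _)
... | inj₂ refl = subst (λ b → suc k ≤ count P k + [ b ]) (sym (all k ≤-refl))
  (≤-trans (≤-reflexive (+-comm 1 k)) (+-monoˡ-≤ 1 (≤-count k (λ j j<k → all j (m<n⇒m<1+n j<k)) ≤-refl)))

count≤m : ∀ {P m} k → (∀ j → m ≤ j → P j ≡ false) → count P k ≤ m
count≤m zero none = z≤n
count≤m {P} {m} (suc k) none with m ≤? k
... | yes m≤k = subst (λ b → count P k + [ b ] ≤ m) (sym (none k m≤k))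
  (≤-trans (≤-reflexive (+-identityʳ _)) (count≤m k none))
... | no m≰k = ≤-trans (count≤ P (suc k)) (≰⇒> m≰k)

-- grid q h ≈ q h is the part size assigned to the parameter q.
grid : ℚ → ℕ → ℕ
grid q h = count (λ j → isYes (frac (suc j) h ℚ.≤? q)) h

grid≤ : ∀ q h → grid q h ≤ h
grid≤ q h = count≤ _ h

grid≤-below : ∀ {q} h c → ¬ (frac (suc c) h ℚ.≤ q) → grid q h ≤ c
grid≤-below {q} h c above = count≤m {P = λ j → isYes (frac (suc j) h ℚ.≤? q)} {m = c} h none
  where
  none : ∀ j → c ≤ j → isYes (frac (suc j) h ℚ.≤? q) ≡ false
  none j c≤j = isYes-false (frac (suc j) h ℚ.≤? q)
    (λ below → above (ℚ.≤-trans (frac-monoˡ-≤ {suc c} {suc j} h (s≤s c≤j)) below))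

frac-grid≤ : ∀ {q} h → 0ℚ ℚ.≤ q → frac (grid q h) h ℚ.≤ q
frac-grid≤ {q} h 0≤q = bound (grid q h) refl
  where
  bound : ∀ c → grid q h ≡ c → frac c h ℚ.≤ q
  bound zero _ = ℚ.≤-trans (frac-≤ {0} {h} {0} {0} z≤n) 0≤q
  bound (suc c) grid≡1+c = decide (frac (suc c) h ℚ.≤? q)
    where
    decide : Dec (frac (suc c) h ℚ.≤ q) → frac (suc c) h ℚ.≤ q
    decide (yes below) = below
    decide (no above) = contradiction (subst (_≤ c) grid≡1+c (grid≤-below {q} h c above)) (<-irrefl refl)

grid-gap : ∀ {x y} h T → 0ℚ ℚ.≤ y → y ℚ.+ frac T h ℚ.≤ x → x ℚ.< 1ℚ → grid y h + T ≤ grid x h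
grid-gap {x} {y} h T 0≤y gap x<1 = ≤-count h all c+T≤h
  where
  c+T≤x : frac (grid y h + T) h ℚ.≤ x
  c+T≤x = ℚ.≤-trans (ℚ.≤-reflexive (sym (frac-+ (grid y h) T h)))
    (ℚ.≤-trans (ℚ.+-monoˡ-≤ (frac T h) (frac-grid≤ {y} h 0≤y)) gap)
  all : ∀ j → j < grid y h + T → isYes (frac (suc j) h ℚ.≤? x) ≡ true
  all j j<c+T = isYes-true (frac (suc j) h ℚ.≤? x)
    (ℚ.≤-trans (frac-monoˡ-≤ {suc j} {grid y h + T} h j<c+T) c+T≤x)
  c+T≤h : grid y h + T ≤ h
  c+T≤h = decide (grid y h + T ≤? h)
    where
    decide : Dec (grid y h + T ≤ h) → grid y h + T ≤ h
    decide (yes c+T≤h) = c+T≤h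
    decide (no c+T≰h) = contradiction (ℚ.<-≤-trans x<1 (ℚ.≤-trans 1≤c+T c+T≤x)) (ℚ.<-irrefl refl)
      where
      1≤c+T : 1ℚ ℚ.≤ frac (grid y h + T) h
      1≤c+T = frac-≤ {1} {0} {grid y h + T} {h}
        (≤-trans (≤-reflexive (+-identityʳ (suc h))) (≤-trans (≰⇒> c+T≰h) (≤-reflexive (sym (*-identityʳ _)))))

grid-spread : ∀ {x y} h K → suc K ≤ h → 0ℚ ℚ.≤ y → y ℚ.+ frac 1 K ℚ.≤ x → x ℚ.< 1ℚ →
  h ≤ 2 * suc K * ∣ grid x h - grid y h ∣
grid-spread {x} {y} h K 1+K≤h 0≤y gap x<1 = begin
  h                                   ≤⟨ m≤2n*[m/n] 1+K≤h ⟩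
  2 * suc K * T                       ≤⟨ *-monoʳ-≤ (2 * suc K) T≤∣gx-gy∣ ⟩
  2 * suc K * ∣ grid x h - grid y h ∣ ∎
  where
  open ≤-Reasoning
  T = h / suc K
  T/h≤1/K : frac T h ℚ.≤ frac 1 K
  T/h≤1/K = frac-≤ {T} {h} {1} {K}
    (≤-trans (m/n*n≤m h (suc K)) (≤-trans (n≤1+n h) (≤-reflexive (sym (*-identityˡ (suc h))))))
  gy+T≤gx : grid y h + T ≤ grid x h
  gy+T≤gx = grid-gap h T 0≤y (ℚ.≤-trans (ℚ.+-monoʳ-≤ y T/h≤1/K) gap) x<1
  T≤∣gx-gy∣ : T ≤ ∣ grid x h - grid y h ∣
  T≤∣gx-gy∣ = ≤-trans (≤-reflexive (sym (m+n∸m≡n (grid y h) T)))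
    (≤-trans (∸-monoˡ-≤ (grid y h) gy+T≤gx) (m∸n≤∣m-n∣ (grid x h) (grid y h)))

GridSeparated : ℝ → ℝ → Set
GridSeparated x y = ∃[ M ] ∃[ N ] ∀ n → N ≤ n → n / 6 ≤ M * ∣ grid (seq x n) (n / 6) - grid (seq y n) (n / 6) ∣

-- A record rather than a function, so that k and z are recovered by unification.
record Regular (k : ℕ) (z : ℕ → ℚ) : Set where
  constructor regular
  field within : ∀ m n → z m ℚ.≤ z n ℚ.+ (frac k m ℚ.+ frac k n)

module _ where
  open import Data.Rational.Solver using (module +-*-Solver)
  open +-*-Solver using (solve; _:+_; _:-_; :-_; _:=_)

  seq-regular : ∀ (x : ℝ) → Regular 1 (seq x)
  seq-regular x = regular λ m n → ≤-add (seq x n) (ℚ.≤-trans (p≤∣p∣ _) (reg x m n))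
    (solve 2 (λ p q → p :- q :+ q := p) refl (seq x m) (seq x n)) (ℚ.+-comm _ (seq x n))

  const-regular : ∀ {k z} c → Regular k z → Regular k (λ n → c ℚ.- z n)
  const-regular {k} {z} c (regular z-reg) = regular λ m n → ≤-add (c ℚ.- z m ℚ.- z n) (z-reg n m)
    (solve 3 (λ c a b → b :+ (c :- a :- b) := c :- a) refl c (z m) (z n))
    (solve 5 (λ c a b s t → a :+ (t :+ s) :+ (c :- a :- b) := c :- b :+ (s :+ t)) refl c (z m) (z n) (frac k m) (frac k n))

  -regular : ∀ {k l z w} → Regular k z → Regular l w → Regular (k + l) (λ n → z n ℚ.- w n)
  -regular {k} {l} {z} {w} (regular z-reg) (regular w-reg) = regular λ m n →
    subst₂ (λ s t → z m ℚ.- w m ℚ.≤ z n ℚ.- w n ℚ.+ (s ℚ.+ t)) (frac-+ k l m) (frac-+ k l n)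
      (≤-add (ℚ.- (w m ℚ.+ w n)) (ℚ.+-mono-≤ (z-reg m n) (w-reg n m))
        (solve 3 (λ a b c → a :+ c :+ :- (b :+ c) := a :- b) refl (z m) (w m) (w n))
        (solve 7 (λ a b c A B C D → a :+ (A :+ B) :+ (b :+ (C :+ D)) :+ :- (b :+ c) := a :- c :+ ((A :+ D) :+ (B :+ C))) refl
          (z n) (w m) (w n) (frac k m) (frac k n) (frac l n) (frac l m)))

  eventually-above : ∀ {k z} → Regular k z → ∀ N → frac k N ℚ.< z N → ∃[ K ] ∀ n → K ≤ n → frac 1 K ℚ.≤ z n
  eventually-above {k} {z} (regular z-reg) N slack<zN = from (archimedean (suc k) 0<ε)
    where
    ε = z N ℚ.- frac k N
    0<ε : 0ℚ ℚ.< ε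
    0<ε = <-add (ℚ.- frac k N) slack<zN (ℚ.+-inverseʳ (frac k N)) refl
    cancel : ∀ p q → p ℚ.+ q ℚ.- q ≡ p
    cancel = solve 2 (λ p q → p :+ q :- q := p) refl
    shift : ∀ a b c → a ℚ.+ (b ℚ.+ c) ℚ.- b ≡ a ℚ.+ c
    shift = solve 3 (λ a b c → a :+ (b :+ c) :- b := a :+ c) refl
    from : ∃[ K ] frac (suc k) K ℚ.≤ ε → ∃[ K ] ∀ n → K ≤ n → frac 1 K ℚ.≤ z n
    from (K , small) = K , λ n K≤n → ≤-add (ℚ.- frac k n) (begin
      frac 1 K ℚ.+ frac k n ≤⟨ ℚ.+-monoʳ-≤ (frac 1 K) (frac-≤ {k} {n} {k} {K} (*-monoʳ-≤ k (s≤s K≤n))) ⟩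
      frac 1 K ℚ.+ frac k K ≡⟨ frac-+ 1 k K ⟩
      frac (suc k) K        ≤⟨ small ⟩
      ε                     ≤⟨ ≤-add (ℚ.- frac k N) (z-reg N n) refl (shift (z n) (frac k N) (frac k n)) ⟩
      z n ℚ.+ frac k n      ∎) (cancel (frac 1 K) (frac k n)) (cancel (z n) (frac k n))
      where open ℚ.≤-Reasoning

  -- x is eventually 1/(K+1) above y, so grid x collects about h/(K+1) more points than grid y.
  -- x is eventually 1/(K+1) above y, so grid x collects about h/(K+1) more points than grid y.
  grid-separated : ∀ (x y : ℝ) → BelowHalf x → Positive y → ∀ N → frac 2 N ℚ.< seq x N ℚ.- seq y N →
    GridSeparated x y
  grid-separated x y (Nx , x<½) (Ny , 0<y) N x-y>slack = combine
    (eventually-above (seq-regular y) Ny 0<y)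
    (eventually-above (const-regular ½ (seq-regular x)) Nx x<½)
    (eventually-above (-regular (seq-regular x) (seq-regular y)) N x-y>slack)
    where
    combine : ∃[ Ky ] (∀ n → Ky ≤ n → frac 1 Ky ℚ.≤ seq y n) →
              ∃[ Kx ] (∀ n → Kx ≤ n → frac 1 Kx ℚ.≤ ½ ℚ.- seq x n) →
              ∃[ K ] (∀ n → K ≤ n → frac 1 K ℚ.≤ seq x n ℚ.- seq y n) →
              GridSeparated x y
    combine (Ky , y-above) (Kx , x-below) (K , x-y-above) = 2 * suc K , Ky + Kx + 6 * suc K , λ n N′≤n →
      let Ky≤n = ≤-trans (≤-trans (m≤m+n Ky Kx) (m≤m+n _ _)) N′≤n
          Kx≤n = ≤-trans (≤-trans (m≤n+m Kx Ky) (m≤m+n _ _)) N′≤n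
          6[1+K]≤n = ≤-trans (m≤n+m _ (Ky + Kx)) N′≤n
      in grid-spread (n / 6) K (1+K≤n/6 6[1+K]≤n) (0≤y n Ky≤n) (y+1/K≤x n (K≤n 6[1+K]≤n))
           (ℚ.≤-<-trans (x≤½ n Kx≤n) ½<1)
      where
      K≤n : ∀ {n} → 6 * suc K ≤ n → K ≤ n
      K≤n 6[1+K]≤n = ≤-trans (n≤1+n K) (≤-trans (m≤n*m (suc K) 6) 6[1+K]≤n)
      1+K≤n/6 : ∀ {n} → 6 * suc K ≤ n → suc K ≤ n / 6
      1+K≤n/6 6[1+K]≤n = ≤-trans (≤-reflexive (sym (m*n/n≡m (suc K) 6)))
        (/-monoˡ-≤ 6 (≤-trans (≤-reflexive (*-comm (suc K) 6)) 6[1+K]≤n))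
      0≤y : ∀ n → Ky ≤ n → 0ℚ ℚ.≤ seq y n
      0≤y n Ky≤n = ℚ.≤-trans (frac-≤ {0} {0} {1} {Ky} z≤n) (y-above n Ky≤n)
      x≤½ : ∀ n → Kx ≤ n → seq x n ℚ.≤ ½
      x≤½ n Kx≤n = ≤-add (seq x n) (ℚ.≤-trans (frac-≤ {0} {0} {1} {Kx} z≤n) (x-below n Kx≤n))
        (ℚ.+-identityˡ (seq x n)) (solve 2 (λ a b → a :- b :+ b := a) refl ½ (seq x n))
      y+1/K≤x : ∀ n → K ≤ n → seq y n ℚ.+ frac 1 K ℚ.≤ seq x n
      y+1/K≤x n K≤n = ≤-add (seq y n) (x-y-above n K≤n)
        (ℚ.+-comm (frac 1 K) (seq y n)) (solve 2 (λ a b → a :- b :+ b := a) refl (seq x n) (seq y n))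

  -[p-q]≡q-p : ∀ p q → ℚ.- (p ℚ.- q) ≡ q ℚ.- p
  -[p-q]≡q-p = solve 2 (λ p q → :- (p :- q) := q :- p) refl

  grid-apart : ∀ α β → Positive α → BelowHalf α → Positive β → BelowHalf β → Apart α β → GridSeparated α β
  grid-apart α β α>0 α<½ β>0 β<½ (N , apart) = by-sign (ℚ.∣p∣≡p∨∣p∣≡-p (seq α N ℚ.- seq β N))
    where
    swap : GridSeparated β α → GridSeparated α β
    swap (M , N′ , separated) = M , N′ , λ n N′≤n →
      subst (λ δ → n / 6 ≤ M * δ) (∣-∣-comm (grid (seq β n) (n / 6)) (grid (seq α n) (n / 6))) (separated n N′≤n)
    d = seq α N ℚ.- seq β N
    by-sign : ℚ.∣ d ∣ ≡ d ⊎ ℚ.∣ d ∣ ≡ ℚ.- d → GridSeparated α β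
    by-sign (inj₁ ∣d∣≡d) = grid-separated α β α<½ β>0 N (subst (frac 2 N ℚ.<_) ∣d∣≡d apart)
    by-sign (inj₂ ∣d∣≡-d) = swap (grid-separated β α β<½ α>0 N
      (subst (frac 2 N ℚ.<_) (trans ∣d∣≡-d (-[p-q]≡q-p (seq α N) (seq β N))) apart))

theorem4p5 : Σ (ℝ → (n : ℕ) → Fin n → TVertex 2 2) λ f →
    ((α : ℝ) → Positive α → BelowHalf α →
      EdgesAsymp (λ n → size (blowup Rtimes (f α n)))
      × EdgesAsympBinom (λ n → size (blowup Rtimes (f α n))))
    × ((α β : ℝ) → Positive α → BelowHalf α → Positive β → BelowHalf β → Apart α β →
      DistOmegaCube (λ n → blowup Rtimes (f α n)) (λ n → blowup Rtimes (f β n)))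
theorem4p5 = (λ α n → R×-partition n (a α n) (a≤h α n))
  , (λ α _ _ → R×-edge-asymptotics (a α) (a≤h α))
  , λ α β α>0 α<½ β>0 β<½ α#β → let M , N , separated = grid-apart α β α>0 α<½ β>0 β<½ α#β in
      R×-distOmegaCube (a α) (a β) (a≤h α) (a≤h β) M N separated
  where
  a : ℝ → ℕ → ℕ
  a α n = grid (seq α n) (n / 6)
  a≤h : ∀ α n → a α n ≤ n / 6
  a≤h α n = grid≤ (seq α n) (n / 6)
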